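{- Let $T$ be a tree on $n$ vertices. Then $k(T)=2$ if and only if $T$ is a star or a balanced double star.
   Context: For a vertex $v$ of a connected graph $G=(V,E)$, the status of $v$ is $s(v)=\sum_{u\in V} d(v,u)$, where $d$ is the shortest-path distance. $k(G)$ denotes the number of distinct values among the statuses of the vertices of $G$. A star is the complete bipartite graph $K_{1,m}$ with $m\ge 2$. A balanced double star is a graph obtained from $K_2$ by appending $a\ge 1$ pendant vertices to each of its two vertices (the same number $a$ for both). -}

module Defs where

open import Level using (0ℓ)
open import Data.Nat using (ℕ; zero; suc; _≤_)
open import Data.Fin using (Fin; inject₁; fromℕ) renaming (zero to fzero; suc to fsuc)
open import Data.List using (tabulate)
open import Data.Nat.ListAction using (sum)
open import Data.Bool using (Bool; true; false)
open import Data.Unit using (⊤)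
open import Data.Empty using (⊥)
open import Data.Sum using (_⊎_; inj₁; inj₂)
open import Data.Product using (Σ; ∃; ∃-syntax; _×_; _,_)
open import Relation.Binary.PropositionalEquality using (_≡_; _≢_)
open import Relation.Nullary using (¬_)
open import Function using (Injective; _⇔_)
open import Function.Bundles using (_↔_; Inverse)

record Graph (V : Set) : Set₁ where
  field
    Adj   : V → V → Set
    sym   : ∀ {u v} → Adj u v → Adj v u
    irrefl : ∀ {v} → ¬ Adj v v
open Graph public

data Walk {V : Set} (G : Graph V) : V → V → ℕ → Set where
  here : ∀ {v} → Walk G v v 0
  step : ∀ {u w v k} → Adj G u w → Walk G w v k → Walk G u v (suc k)

Connected : ∀ {V} → Graph V → Set
Connected G = ∀ u v → ∃[ k ] Walk G u v k

-- A cycle of length suc m ≥ 3: distinct vertices c 0, …, c m,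
-- consecutive ones adjacent and c m adjacent to c 0.
HasCycle : ∀ {V} → Graph V → Set
HasCycle {V} G =
  ∃[ m ] Σ (Fin (suc m) → V) λ c →
    (2 ≤ m) × Injective _≡_ _≡_ c ×
    (∀ (i : Fin m) → Adj G (c (inject₁ i)) (c (fsuc i))) ×
    Adj G (c (fromℕ m)) (c fzero)

Acyclic : ∀ {V} → Graph V → Set
Acyclic G = ¬ HasCycle G

IsTree : ∀ {V} → Graph V → Set
IsTree G = Connected G × Acyclic G

Dist : ∀ {V} → Graph V → V → V → ℕ → Set
Dist G u v m = Walk G u v m × (∀ k → Walk G u v k → m ≤ k)

Status : ∀ {n} → Graph (Fin n) → Fin n → ℕ → Set
Status {n} G v s =
  Σ (Fin n → ℕ) λ d → (∀ u → Dist G v u (d u)) × sum (tabulate d) ≡ s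

-- k(G) = 2 : the statuses take exactly two distinct values
KIsTwo : ∀ {n} → Graph (Fin n) → Set
KIsTwo {n} G =
  ∃[ s ] ∃[ t ] (s ≢ t) ×
    (∀ v → Status G v s ⊎ Status G v t) ×
    (∃[ v ] Status G v s) × (∃[ v ] Status G v t)

_≅_ : ∀ {V W} → Graph V → Graph W → Set
_≅_ {V} {W} G H =
  Σ (V ↔ W) λ f → ∀ u v → Adj G u v ⇔ Adj H (Inverse.to f u) (Inverse.to f v)

-- The star K_{1,m}: centre inj₁ tt, leaves inj₂ i

StarAdj : ∀ m → (⊤ ⊎ Fin m) → (⊤ ⊎ Fin m) → Set
StarAdj m (inj₁ _) (inj₂ _) = ⊤
StarAdj m (inj₂ _) (inj₁ _) = ⊤
StarAdj m _ _ = ⊥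

K1 : ∀ m → Graph (⊤ ⊎ Fin m)
K1 m = record { Adj = StarAdj m ; sym = s ; irrefl = ir }
  where
  s : ∀ {u v} → StarAdj m u v → StarAdj m v u
  s {inj₁ _} {inj₂ _} p = p
  s {inj₂ _} {inj₁ _} p = p
  ir : ∀ {v} → ¬ StarAdj m v v
  ir {inj₁ _} ()
  ir {inj₂ _} ()

-- Balanced double star: K_2 on centres inj₁ true, inj₁ false;
-- a pendant vertices inj₂ (b , i) attached to centre inj₁ b.
DSAdj : ∀ a → (Bool ⊎ (Bool × Fin a)) → (Bool ⊎ (Bool × Fin a)) → Set
DSAdj a (inj₁ true) (inj₁ false) = ⊤
DSAdj a (inj₁ false) (inj₁ true) = ⊤
DSAdj a (inj₁ true) (inj₁ true) = ⊥
DSAdj a (inj₁ false) (inj₁ false) = ⊥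
DSAdj a (inj₁ b) (inj₂ (c , _)) = b ≡ c
DSAdj a (inj₂ (c , _)) (inj₁ b) = b ≡ c
DSAdj a (inj₂ _) (inj₂ _) = ⊥

DS : ∀ a → Graph (Bool ⊎ (Bool × Fin a))
DS a = record { Adj = DSAdj a ; sym = s ; irrefl = ir }
  where
  s : ∀ {u v} → DSAdj a u v → DSAdj a v u
  s {inj₁ true} {inj₁ false} p = p
  s {inj₁ false} {inj₁ true} p = p
  s {inj₁ true} {inj₂ (_ , _)} p = p
  s {inj₁ false} {inj₂ (_ , _)} p = p
  s {inj₂ (_ , _)} {inj₁ true} p = p
  s {inj₂ (_ , _)} {inj₁ false} p = p
  ir : ∀ {v} → ¬ DSAdj a v v
  ir {inj₁ true} ()
  ir {inj₁ false} ()
  ir {inj₂ (_ , _)} ()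

IsStar : ∀ {V} → Graph V → Set
IsStar G = ∃[ m ] (2 ≤ m) × (G ≅ K1 m)

IsBalancedDoubleStar : ∀ {V} → Graph V → Set
IsBalancedDoubleStar G = ∃[ a ] (1 ≤ a) × (G ≅ DS a)

-- If a vertex b of a tree has two distinct neighbours a and c, then for every vertex z at most
-- one of them is not farther from z than b is, since otherwise the two geodesics towards z would
-- close a cycle; hence 2 s(b) < s(a) + s(c).  So when the statuses take only two values, every
-- vertex with two neighbours has the smaller status and no two of its neighbours do.  Such a
-- vertex b exists, as otherwise every status is n - 1.  If no neighbour of b has two neighbours,
-- T is a star centred at b.  Otherwise such a neighbour c is unique, every other vertex is a leaf
-- at b or at c, and s(b) = s(c) says that both sides have the same size, because
-- s(c) - s(b) = n_b - n_c across an edge.  Conversely a leaf at p has status s(p) + n - 2, and the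
-- two centres of a balanced double star are exchanged by an automorphism.

module Submission where

open import Defs hiding (sym)
open import Data.Bool using (Bool; true; false; not; if_then_else_; T)
open import Data.Empty using (⊥-elim)
open import Data.Fin using (Fin; zero; suc; inject₁; fromℕ; punchIn; punchOut)
import Data.Fin.Properties as Finₚ
open Finₚ using (any?) renaming (_≟_ to _≟ᶠ_)
open import Data.List using (List; []; _∷_; _∷ʳ_; length; lookup; tabulate)
open import Data.List.Properties using (length-++)
open import Data.List.Membership.Propositional using (_∈_; _∉_)
open import Data.List.Membership.Propositional.Properties using (∈-lookup; ∈-++⁺ʳ; ∈-++⁻)
open import Data.List.Relation.Unary.All as All using (All; []; _∷_)
open import Data.List.Relation.Unary.All.Properties using (¬Any⇒All¬; ∷ʳ⁺)
open import Data.List.Relation.Unary.Any using (here; there)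
open import Data.List.Relation.Unary.AllPairs using ([]; _∷_)
open import Data.List.Relation.Unary.Linked using (Linked; []; [-]; _∷_)
open import Data.List.Relation.Unary.Unique.Propositional using (Unique)
import Data.List.Relation.Unary.Unique.Propositional.Properties as Unique
open import Data.Nat using (ℕ; zero; suc; _+_; _≤_; _<_; _<ᵇ_; _≟_; _≤?_; z≤n; s≤s)
open import Data.Nat.ListAction using (sum)
open import Data.Nat.Properties
open import Data.Nat.Tactic.RingSolver using (solve-∀)
open import Data.Product as Product using (Σ-syntax; ∃; ∃-syntax; _×_; _,_; proj₁; proj₂)
open import Data.Sum as Sum using (_⊎_; inj₁; inj₂; map₁; [_,_]′)
open import Data.Sum.Algebra using (⊎-comm)
open import Data.Sum.Function.Propositional using (_⊎-↔_)
open import Data.Sum.Properties as Sumₚ using (inj₁-injective; inj₂-injective)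
import Data.Product.Properties as Productₚ
import Data.Bool.Properties as Boolₚ
import Data.Unit.Properties as ⊤ₚ
open import Data.Unit using (⊤; tt)
open import Function using (_∘_; id; _⇔_; mk⇔; Injective; _↔_; Inverse; Equivalence; mk↔ₛ′)
open import Function.Properties.Inverse using (↔-sym; ↔-trans)
open import Relation.Binary.Definitions using (DecidableEquality; Tri; tri<; tri≈; tri>)
open import Relation.Binary.PropositionalEquality
open import Relation.Nullary using (¬_; Dec; yes; no; contradiction; ¬?; _×-dec_)
import Algebra.Properties.CommutativeMonoid.Sum as CommutativeMonoidSum

-- Sums over Fin n

∑ : ∀ {n} → (Fin n → ℕ) → ℕ
∑ f = sum (tabulate f)

module ℕ-Sum = CommutativeMonoidSum +-0-commutativeMonoid

∑≡sum : ∀ {n} (f : Fin n → ℕ) → ∑ f ≡ ℕ-Sum.sum f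
∑≡sum {zero} f = refl
∑≡sum {suc n} f = cong (f zero +_) (∑≡sum (f ∘ suc))

∑-cong : ∀ {n} {f g : Fin n → ℕ} → (∀ i → f i ≡ g i) → ∑ f ≡ ∑ g
∑-cong {zero} f≗g = refl
∑-cong {suc n} f≗g = cong₂ _+_ (f≗g zero) (∑-cong (f≗g ∘ suc))

∑-distrib-+ : ∀ {n} (f g : Fin n → ℕ) → ∑ (λ i → f i + g i) ≡ ∑ f + ∑ g
∑-distrib-+ f g = begin
  ∑ (λ i → f i + g i)           ≡⟨ ∑≡sum (λ i → f i + g i) ⟩
  ℕ-Sum.sum (λ i → f i + g i)   ≡⟨ ℕ-Sum.∑-distrib-+ f g ⟩
  ℕ-Sum.sum f + ℕ-Sum.sum g     ≡⟨ sym (cong₂ _+_ (∑≡sum f) (∑≡sum g)) ⟩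
  ∑ f + ∑ g                     ∎
  where open ≡-Reasoning

∑-const-1 : ∀ n → ∑ {n} (λ _ → 1) ≡ n
∑-const-1 zero = refl
∑-const-1 (suc n) = cong suc (∑-const-1 n)

∑-mono-≤ : ∀ {n} {f g : Fin n → ℕ} → (∀ i → f i ≤ g i) → ∑ f ≤ ∑ g
∑-mono-≤ {zero} f≤g = z≤n
∑-mono-≤ {suc n} f≤g = +-mono-≤ (f≤g zero) (∑-mono-≤ (f≤g ∘ suc))

∑-mono-< : ∀ {n} {f g : Fin n → ℕ} → (∀ i → f i ≤ g i) → ∀ j → f j < g j → ∑ f < ∑ g
∑-mono-< f≤g zero fj<gj = +-mono-<-≤ fj<gj (∑-mono-≤ (f≤g ∘ suc))
∑-mono-< f≤g (suc j) fj<gj = +-mono-≤-< (f≤g zero) (∑-mono-< (f≤g ∘ suc) j fj<gj)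

∑-agree-off : ∀ {n} {f g : Fin n → ℕ} (j : Fin n) → (∀ i → i ≢ j → f i ≡ g i) →
              ∑ f + g j ≡ ∑ g + f j
∑-agree-off {suc n} {f} {g} zero f≗g = begin
  f zero + ∑ (f ∘ suc) + g zero   ≡⟨ cong (λ s → f zero + s + g zero) (∑-cong {f = f ∘ suc} tail) ⟩
  f zero + ∑ (g ∘ suc) + g zero   ≡⟨ swap-ends (f zero) _ (g zero) ⟩
  g zero + ∑ (g ∘ suc) + f zero   ∎
  where
  open ≡-Reasoning
  tail : ∀ i → f (suc i) ≡ g (suc i)
  tail i = f≗g (suc i) λ ()
  swap-ends : ∀ a s b → a + s + b ≡ b + s + a
  swap-ends = solve-∀
∑-agree-off {suc n} {f} {g} (suc j) f≗g = begin
  f zero + ∑ (f ∘ suc) + g (suc j)   ≡⟨ +-assoc (f zero) _ _ ⟩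
  f zero + (∑ (f ∘ suc) + g (suc j)) ≡⟨ cong₂ _+_ (f≗g zero λ ()) (∑-agree-off j tail) ⟩
  g zero + (∑ (g ∘ suc) + f (suc j)) ≡⟨ +-assoc (g zero) _ _ ⟨
  g zero + ∑ (g ∘ suc) + f (suc j)   ∎
  where
  open ≡-Reasoning
  tail : ∀ i → i ≢ j → f (suc i) ≡ g (suc i)
  tail i i≢j = f≗g (suc i) (i≢j ∘ Finₚ.suc-injective)

∑-permute : ∀ {n} (f : Fin n → ℕ) (π : Fin n ↔ Fin n) → ∑ f ≡ ∑ (f ∘ Inverse.to π)
∑-permute f π = trans (∑≡sum f) (trans (ℕ-Sum.sum-permute f π) (sym (∑≡sum (f ∘ Inverse.to π))))

count : ∀ {n} → (Fin n → Bool) → ℕ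
count p = ∑ (λ u → if p u then 1 else 0)

3≤-of-distinct : ∀ {n} {x y z : Fin n} → x ≢ y → x ≢ z → y ≢ z → 3 ≤ n
3≤-of-distinct {x = x} {y} {z} x≢y x≢z y≢z = Finₚ.injective⇒≤ {f = triple} injective
  where
  triple : Fin 3 → Fin _
  triple zero = x
  triple (suc zero) = y
  triple (suc (suc zero)) = z
  injective : Injective _≡_ _≡_ triple
  injective {zero} {zero} _ = refl
  injective {zero} {suc zero} e = ⊥-elim (x≢y e)
  injective {zero} {suc (suc zero)} e = ⊥-elim (x≢z e)
  injective {suc zero} {zero} e = ⊥-elim (x≢y (sym e))
  injective {suc zero} {suc zero} _ = refl
  injective {suc zero} {suc (suc zero)} e = ⊥-elim (y≢z e)
  injective {suc (suc zero)} {zero} e = ⊥-elim (x≢z (sym e))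
  injective {suc (suc zero)} {suc zero} e = ⊥-elim (y≢z (sym e))
  injective {suc (suc zero)} {suc (suc zero)} _ = refl

1≤-of-distinct : ∀ {a} {i j : Fin (suc a)} → i ≢ j → 1 ≤ a
1≤-of-distinct {zero} {zero} {zero} i≢j = ⊥-elim (i≢j refl)
1≤-of-distinct {suc a} _ = s≤s z≤n

-- Walks, distances and isomorphisms

Pendant : ∀ {V} → Graph V → V → V → Set
Pendant G u p = Adj G u p × (∀ v → Adj G u v → v ≡ p)

Internal : ∀ {V} → Graph V → V → Set
Internal {V} G b = Σ[ a ∈ V ] Σ[ c ∈ V ] Adj G b a × Adj G b c × a ≢ c

module _ {V : Set} (G : Graph V) where

  adj⇒≢ : ∀ {u v} → Adj G u v → u ≢ v
  adj⇒≢ uv refl = irrefl G uv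

  Dist-unique : ∀ {u v d d′} → Dist G u v d → Dist G u v d′ → d ≡ d′
  Dist-unique (w , min) (w′ , min′) = ≤-antisym (min _ w′) (min′ _ w)

  Dist-refl : ∀ {u} → Dist G u u 0
  Dist-refl = here , λ _ _ → z≤n

  Dist-adj : ∀ {u v} → Adj G u v → Dist G u v 1
  Dist-adj uv = step uv here , λ where
    .zero here → ⊥-elim (irrefl G uv)
    .(suc _) (step _ _) → s≤s z≤n

  Dist-two : ∀ {u w v} → u ≢ v → ¬ Adj G u v → Adj G u w → Adj G w v → Dist G u v 2
  Dist-two u≢v ¬uv uw wv = step uw (step wv here) , λ where
    .zero here → ⊥-elim (u≢v refl)
    .1 (step uv here) → ⊥-elim (¬uv uv)
    .(suc (suc _)) (step _ (step _ _)) → s≤s (s≤s z≤n)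

  Dist-pendant : ∀ {u p w d} → Pendant G u p → Dist G p w d → w ≢ u → Dist G u w (suc d)
  Dist-pendant (up , only-p) (w , min) w≢u = step up w , λ where
    .zero here → ⊥-elim (w≢u refl)
    .(suc _) (step ux w′) → s≤s (min _ (subst (λ x → Walk G x _ _) (only-p _ ux) w′))

∃Dist-pendant : ∀ {V} (_≟_ : DecidableEquality V) (G : Graph V) {u p} → Pendant G u p →
                (∀ y → ∃[ d ] Dist G p y d) → ∀ y → ∃[ d ] Dist G u y d
∃Dist-pendant _≟_ G {u} u-pendant dist-p y with y ≟ u
... | yes refl = 0 , Dist-refl G
... | no y≢u = _ , Dist-pendant G u-pendant (proj₂ (dist-p y)) y≢u

module _ {A B : Set} (e : A ↔ B) where
  open Inverse e

  from-injective : ∀ {x y} → from x ≡ from y → x ≡ y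
  from-injective {x} {y} eq = trans (sym (strictlyInverseˡ x)) (trans (cong to eq) (strictlyInverseˡ y))

  to-injective : ∀ {u v} → to u ≡ to v → u ≡ v
  to-injective {u} {v} eq = trans (sym (strictlyInverseʳ u)) (trans (cong from eq) (strictlyInverseʳ v))

  to≡⇒from≡ : ∀ {u y} → to u ≡ y → from y ≡ u
  to≡⇒from≡ {u} e = trans (cong from (sym e)) (strictlyInverseʳ u)

  by-image : {P : A → Set} → (∀ x → P (from x)) → ∀ u → P u
  by-image {P} P-from u = subst P (strictlyInverseʳ u) (P-from (to u))

map-walk : ∀ {V W} {G : Graph V} {H : Graph W} (f : V → W) → (∀ {u v} → Adj G u v → Adj H (f u) (f v)) →
           ∀ {u v k} → Walk G u v k → Walk H (f u) (f v) k
map-walk f hom here = here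
map-walk f hom (step uw w) = step (hom uw) (map-walk f hom w)

module _ {V W : Set} {G : Graph V} {H : Graph W} (f : G ≅ H) where
  private
    module f = Inverse (proj₁ f)

  to-adj : ∀ {u v} → Adj G u v → Adj H (f.to u) (f.to v)
  to-adj = Equivalence.to (proj₂ f _ _)

  from-adj : ∀ {x y} → Adj H x y → Adj G (f.from x) (f.from y)
  from-adj {x} {y} xy =
    Equivalence.from (proj₂ f _ _)
      (subst₂ (Adj H) (sym (f.strictlyInverseˡ x)) (sym (f.strictlyInverseˡ y)) xy)

  Dist-reflect : ∀ {u v d} → Dist H (f.to u) (f.to v) d → Dist G u v d
  Dist-reflect {u} {v} (w , min) =
    subst₂ (λ a b → Walk G a b _) (f.strictlyInverseʳ u) (f.strictlyInverseʳ v)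
           (map-walk f.from from-adj w) ,
    λ k w′ → min k (map-walk f.to to-adj w′)

  Pendant-from : ∀ {x p} → Pendant H x p → Pendant G (f.from x) (f.from p)
  Pendant-from {x} (xp , only-p) = from-adj xp , λ v uv →
    trans (sym (f.strictlyInverseʳ v))
          (cong f.from (only-p _ (subst (λ a → Adj H a (f.to v)) (f.strictlyInverseˡ x) (to-adj uv))))

∃Dist-reflect : ∀ {V W} {G : Graph V} {H : Graph W} (f : G ≅ H) →
                (∀ x y → ∃[ d ] Dist H x y d) → ∀ u v → ∃[ d ] Dist G u v d
∃Dist-reflect {G = G} {H} f dist-H u v =
  proj₁ (dist-H _ _) , Dist-reflect {G = G} {H} f (proj₂ (dist-H _ _))

≅-sym : ∀ {V W} {G : Graph V} {H : Graph W} → G ≅ H → H ≅ G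
≅-sym {G = G} {H} f = ↔-sym (proj₁ f) , λ x y →
  mk⇔ (from-adj {G = G} {H} f) (subst₂ (Adj H) (to-from x) (to-from y) ∘ to-adj {G = G} {H} f)
  where
  open Inverse (proj₁ f) using () renaming (strictlyInverseˡ to to-from)

≅-trans : ∀ {U V W} {F : Graph U} {G : Graph V} {H : Graph W} → F ≅ G → G ≅ H → F ≅ H
≅-trans {F = F} {G} {H} f g = ↔-trans (proj₁ f) (proj₁ g) , λ u v →
  mk⇔ (to-adj {G = G} {H} g ∘ to-adj {G = F} {G} f)
      (Equivalence.from (proj₂ f u v) ∘ Equivalence.from (proj₂ g _ _))

≅-of-from : ∀ {V W} {G : Graph V} {H : Graph W} (e : V ↔ W) →
            (∀ x y → Adj G (Inverse.from e x) (Inverse.from e y) ⇔ Adj H x y) → G ≅ H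
≅-of-from {G = G} {H} e adj = e , λ u v →
  subst₂ (λ a b → Adj G a b ⇔ Adj H (Inverse.to e u) (Inverse.to e v))
         (Inverse.strictlyInverseʳ e u) (Inverse.strictlyInverseʳ e v) (adj _ _)

module Metric {V : Set} (G : Graph V) (D : V → V → ℕ) (dist : ∀ u v → Dist G u v (D u v)) where

  geodesic : ∀ u v → Walk G u v (D u v)
  geodesic u v = proj₁ (dist u v)

  D-minimal : ∀ {u v k} → Walk G u v k → D u v ≤ k
  D-minimal w = proj₂ (dist _ _) _ w

  D-refl : ∀ u → D u u ≡ 0
  D-refl u = n≤0⇒n≡0 (D-minimal here)

  D≡0⇒≡ : ∀ {u v} → D u v ≡ 0 → u ≡ v
  D≡0⇒≡ {u} {v} e with subst (Walk G u v) e (geodesic u v)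
  ... | here = refl

  D-step : ∀ {u x v} → Adj G u x → D u v ≤ suc (D x v)
  D-step ux = D-minimal (step ux (geodesic _ _))

  adj⇒D≡1 : ∀ {u v} → Adj G u v → D u v ≡ 1
  adj⇒D≡1 uv = Dist-unique G (dist _ _) (Dist-adj G uv)

  D≡1⇒adj : ∀ {u v} → D u v ≡ 1 → Adj G u v
  D≡1⇒adj {u} {v} e with subst (Walk G u v) e (geodesic u v)
  ... | step uv here = uv

  adj? : ∀ u v → Dec (Adj G u v)
  adj? u v with D u v ≟ 1
  ... | yes e = yes (D≡1⇒adj e)
  ... | no e = no (e ∘ adj⇒D≡1)

  towards : ∀ {u v d} → D u v ≡ suc d → Σ[ x ∈ V ] Adj G u x × D x v ≡ d
  towards {u} {v} {d} e with subst (Walk G u v) e (geodesic u v)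
  ... | step {w = x} ux w =
    x , ux , ≤-antisym (D-minimal w) (≤-pred (subst (_≤ suc (D x v)) e (D-step ux)))

  internal-towards : ∀ {u v d} → D u v ≡ suc (suc d) →
                     Σ[ x ∈ V ] Adj G u x × Internal G x × D x v ≡ suc d
  internal-towards {u} {v} {d} e with towards e
  ... | x , ux , ex with towards ex
  ...   | y , xy , ey = x , ux , (u , y , Graph.sym G ux , xy , u≢y) , ex
    where
    u≢y : u ≢ y
    u≢y refl = <⇒≢ (m<n⇒m<1+n (n<1+n d)) (trans (sym ey) e)

  pendant-distance : ∀ {u p w} → Pendant G u p → w ≢ u → D u w ≡ suc (D p w)
  pendant-distance u-pendant w≢u = Dist-unique G (dist _ _) (Dist-pendant G u-pendant (dist _ _) w≢u)

  D-invariant : (σ : G ≅ G) → ∀ u w → D (Inverse.to (proj₁ σ) u) (Inverse.to (proj₁ σ) w) ≡ D u w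
  D-invariant σ u w = Dist-unique G (Dist-reflect σ (dist _ _)) (dist u w)

  adjacent-or-internal-towards : ∀ {u v} → u ≢ v → Adj G u v ⊎ Σ[ x ∈ V ] Adj G u x × Internal G x
  adjacent-or-internal-towards {u} {v} u≢v with D u v in e
  ... | zero = ⊥-elim (u≢v (D≡0⇒≡ e))
  ... | suc zero = inj₁ (D≡1⇒adj e)
  ... | suc (suc _) with internal-towards e
  ...   | x , ux , Ix , _ = inj₂ (x , ux , Ix)

-- Acyclic graphs

lookup-injective : ∀ {A : Set} {xs : List A} → Unique xs → Injective _≡_ _≡_ (lookup xs)
lookup-injective (_ ∷ _) {zero} {zero} _ = refl
lookup-injective (x≢xs ∷ _) {zero} {suc j} e = ⊥-elim (All.lookup x≢xs (∈-lookup j) e)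
lookup-injective (x≢xs ∷ _) {suc i} {zero} e = ⊥-elim (All.lookup x≢xs (∈-lookup i) (sym e))
lookup-injective (_ ∷ u) {suc i} {suc j} e = cong suc (lookup-injective u e)

Linked-lookup : ∀ {A : Set} {R : A → A → Set} {x xs} → Linked R (x ∷ xs) →
                (i : Fin (length xs)) → R (lookup (x ∷ xs) (inject₁ i)) (lookup (x ∷ xs) (suc i))
Linked-lookup {xs = _ ∷ _} (r ∷ _) zero = r
Linked-lookup {xs = _ ∷ _} (_ ∷ l) (suc i) = Linked-lookup l i

lookup-∷ʳ-last : ∀ {A : Set} (x : A) xs y → lookup (x ∷ xs ∷ʳ y) (fromℕ (length (xs ∷ʳ y))) ≡ y
lookup-∷ʳ-last x [] y = refl
lookup-∷ʳ-last x (x′ ∷ xs) y = lookup-∷ʳ-last x′ xs y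

Unique-∷ʳ : ∀ {A : Set} {xs : List A} {y} → Unique xs → y ∉ xs → Unique (xs ∷ʳ y)
Unique-∷ʳ u y∉xs = Unique.++⁺ u ([] ∷ []) λ { (y∈xs , here refl) → y∉xs y∈xs }

Linked-∷ʳ : ∀ {A : Set} {R : A → A → Set} xs {y z} → Linked R (xs ∷ʳ y) → R y z → Linked R (xs ∷ʳ y ∷ʳ z)
Linked-∷ʳ [] _ r = r ∷ [-]
Linked-∷ʳ (_ ∷ []) (r₀ ∷ _) r = r₀ ∷ r ∷ [-]
Linked-∷ʳ (_ ∷ x′ ∷ xs) (r₀ ∷ l) r = r₀ ∷ Linked-∷ʳ (x′ ∷ xs) l r

cycle-of-path : ∀ {V} (G : Graph V) {x w y : V} (ι : List V) →
                Unique (x ∷ w ∷ ι ∷ʳ y) → Linked (Adj G) (x ∷ w ∷ ι ∷ʳ y) → Adj G y x → HasCycle G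
cycle-of-path G {x} {w} {y} ι u l yx =
  length (w ∷ ι ∷ʳ y) , lookup (x ∷ w ∷ ι ∷ʳ y) ,
  s≤s (subst (1 ≤_) (sym (length-++ ι)) (m≤n+m 1 (length ι))) ,
  lookup-injective u , Linked-lookup l ,
  subst (λ v → Adj G v x) (sym (lookup-∷ʳ-last x (w ∷ ι) y)) yx

pred-larger-summandˡ : ∀ {a b s} → b ≤ a → a + b ≡ suc s → ∃[ d ] a ≡ suc d × d + b ≡ s
pred-larger-summandˡ {suc d} _ e = d , refl , suc-injective e
pred-larger-summandˡ {zero} z≤n ()

pred-larger-summandʳ : ∀ {a b s} → a < b → a + b ≡ suc s → ∃[ d ] b ≡ suc d × a + d ≡ s
pred-larger-summandʳ {a} {suc d} _ e = d , refl , suc-injective (trans (sym (+-suc a d)) e)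

module AcyclicMetric {V : Set} (_≟_ : DecidableEquality V) (G : Graph V) (acyclic : Acyclic G)
                     (D : V → V → ℕ) (dist : ∀ u v → Dist G u v (D u v)) where

  open Metric G D dist

  module _ (z : V) where

    fresh : ∀ {x w y u k} ι → All (λ v → k ≤ D v z) (w ∷ ι) → D u z < k → u ≢ x → u ≢ y →
            u ∉ x ∷ w ∷ ι ∷ʳ y
    fresh ι _ _ u≢x _ (here refl) = u≢x refl
    fresh ι far u<k _ u≢y (there u∈) with ∈-++⁻ (_ ∷ ι) u∈
    ... | inj₁ u∈inner = <⇒≱ u<k (All.lookup far u∈inner)
    ... | inj₂ (here refl) = u≢y refl

    -- Move the end farther from z one edge towards z: the new vertex is nearer to z than every
    -- inner vertex, so it is either the other end, which closes a cycle, or a fresh vertex.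
    cycle-of-far-path : ∀ s {x w y} ι → D x z + D y z ≡ s →
                        Unique (x ∷ w ∷ ι ∷ʳ y) → Linked (Adj G) (x ∷ w ∷ ι ∷ʳ y) →
                        All (λ v → D x z ≤ D v z × D y z ≤ D v z) (w ∷ ι) → HasCycle G
    cycle-of-far-path zero {x} {w} {y} ι e u _ _ =
      ⊥-elim (Unique.Unique[x∷xs]⇒x∉xs u (subst (_∈ w ∷ ι ∷ʳ y) (sym x≡y) (∈-++⁺ʳ (w ∷ ι) (here refl))))
      where
      x≡y : x ≡ y
      x≡y = trans (D≡0⇒≡ (m+n≡0⇒m≡0 _ e)) (sym (D≡0⇒≡ (m+n≡0⇒n≡0 _ e)))
    cycle-of-far-path (suc s) {x} {w} {y} ι e u l far with D y z ≤? D x z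
    ... | yes y≤x with pred-larger-summandˡ y≤x e
    ...   | d , x≡1+d , e′ with towards x≡1+d
    ...     | x′ , xx′ , x′≡d with x′ ≟ y
    ...       | yes refl = cycle-of-path G ι u l (Graph.sym G xx′)
    ...       | no x′≢y =
      cycle-of-far-path s (w ∷ ι) (trans (cong (_+ D y z) x′≡d) e′)
        (¬Any⇒All¬ _ (fresh ι (All.map proj₁ far) x′<x (adj⇒≢ G xx′ ∘ sym) x′≢y) ∷ u)
        (Graph.sym G xx′ ∷ l)
        ((<⇒≤ x′<x , y≤x) ∷ All.map (λ (x≤v , y≤v) → ≤-trans (<⇒≤ x′<x) x≤v , y≤v) far)
      where
      x′<x : D x′ z < D x z
      x′<x = subst₂ _<_ (sym x′≡d) (sym x≡1+d) (n<1+n d)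
    cycle-of-far-path (suc s) {x} {w} {y} ι e u l far | no y≰x with pred-larger-summandʳ (≰⇒> y≰x) e
    ...   | d , y≡1+d , e′ with towards y≡1+d
    ...     | y′ , yy′ , y′≡d with y′ ≟ x
    ...       | yes refl = cycle-of-path G ι u l yy′
    ...       | no y′≢x =
      cycle-of-far-path s (ι ∷ʳ y) (trans (cong (D x z +_) y′≡d) e′)
        (Unique-∷ʳ u (fresh ι (All.map proj₂ far) y′<y y′≢x (adj⇒≢ G yy′ ∘ sym)))
        (Linked-∷ʳ (x ∷ w ∷ ι) l yy′)
        (∷ʳ⁺ (All.map (λ (x≤v , y≤v) → x≤v , ≤-trans (<⇒≤ y′<y) y≤v) far) (<⇒≤ (≰⇒> y≰x) , <⇒≤ y′<y))
      where
      y′<y : D y′ z < D y z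
      y′<y = subst₂ _<_ (sym y′≡d) (sym y≡1+d) (n<1+n d)

  not-farther-neighbour-unique : ∀ {a b c z} → Adj G b a → Adj G b c →
                                 D a z ≤ D b z → D c z ≤ D b z → a ≡ c
  not-farther-neighbour-unique {a} {b} {c} {z} ba bc a≤b c≤b with a ≟ c
  ... | yes a≡c = a≡c
  ... | no a≢c =
    ⊥-elim (acyclic (cycle-of-far-path z _ [] refl path (Graph.sym G ba ∷ bc ∷ [-]) ((a≤b , c≤b) ∷ [])))
    where
    path : Unique (a ∷ b ∷ c ∷ [])
    path = (adj⇒≢ G (Graph.sym G ba) ∷ a≢c ∷ []) ∷ (adj⇒≢ G bc ∷ []) ∷ [] ∷ []

  adjacent-distances-differ : ∀ {b c u} → Adj G b c → D b u ≢ D c u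
  adjacent-distances-differ {b} {c} {u} bc b≡c with D b u in e
  ... | zero = adj⇒≢ G bc (trans (D≡0⇒≡ e) (sym (D≡0⇒≡ (sym b≡c))))
  ... | suc d with towards e
  ...   | b′ , bb′ , b′≡d
          with not-farther-neighbour-unique bb′ bc (subst₂ _≤_ (sym b′≡d) (sym e) (n≤1+n d))
                                                   (≤-reflexive (trans (sym b≡c) (sym e)))
  ...     | refl = 1+n≢n (trans b≡c b′≡d)

  adjacent-distances : ∀ {b c} → Adj G b c → ∀ u → D c u ≡ suc (D b u) ⊎ D b u ≡ suc (D c u)
  adjacent-distances {b} {c} bc u with <-cmp (D b u) (D c u)
  ... | tri< b<c _ _ = inj₁ (≤-antisym (D-step (Graph.sym G bc)) b<c)
  ... | tri≈ _ b≡c _ = ⊥-elim (adjacent-distances-differ bc b≡c)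
  ... | tri> _ _ c<b = inj₂ (≤-antisym (D-step bc) c<b)

  distance-convex : ∀ {a b c} → Adj G b a → Adj G b c → a ≢ c → ∀ z → D b z + D b z ≤ D a z + D c z
  distance-convex {a} {b} {c} ba bc a≢c z with D a z ≤? D b z | D c z ≤? D b z
  ... | yes a≤b | yes c≤b = ⊥-elim (a≢c (not-farther-neighbour-unique ba bc a≤b c≤b))
  ... | yes _   | no c≰b  = ≤-pred (+-mono-≤-< (D-step ba) (≰⇒> c≰b))
  ... | no a≰b  | yes _   =
    ≤-pred (subst (D b z + D b z <_) (+-suc _ _) (+-mono-<-≤ (≰⇒> a≰b) (D-step bc)))
  ... | no a≰b  | no c≰b  = +-mono-≤ (<⇒≤ (≰⇒> a≰b)) (<⇒≤ (≰⇒> c≰b))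

-- Stars and double stars up to isomorphism

star-of-bijection : ∀ {V m} (G : Graph V) (e : V ↔ (⊤ ⊎ Fin m)) →
                    (∀ i → Pendant G (Inverse.from e (inj₂ i)) (Inverse.from e (inj₁ tt))) → G ≅ K1 m
star-of-bijection {m = m} G e leaf = ≅-of-from {G = G} {K1 m} e adjacency
  where
  adjacency : ∀ x y → Adj G (Inverse.from e x) (Inverse.from e y) ⇔ StarAdj m x y
  adjacency (inj₁ _) (inj₁ _) = mk⇔ (irrefl G) λ ()
  adjacency (inj₁ _) (inj₂ j) = mk⇔ _ λ _ → Graph.sym G (proj₁ (leaf j))
  adjacency (inj₂ i) (inj₁ _) = mk⇔ _ λ _ → proj₁ (leaf i)
  adjacency (inj₂ i) (inj₂ j) = mk⇔ (λ ij → inj₂≢inj₁ (from-injective e (proj₂ (leaf i) _ ij))) λ ()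
    where
    inj₂≢inj₁ : inj₂ j ≢ inj₁ tt
    inj₂≢inj₁ ()

double-star-of-bijection : ∀ {V a} (G : Graph V) (e : V ↔ (Bool ⊎ (Bool × Fin a))) →
  Adj G (Inverse.from e (inj₁ true)) (Inverse.from e (inj₁ false)) →
  (∀ β i → Pendant G (Inverse.from e (inj₂ (β , i))) (Inverse.from e (inj₁ β))) →
  G ≅ DS a
double-star-of-bijection {a = a} G e centres leaf = ≅-of-from {G = G} {DS a} e adjacency
  where
  open Inverse e using (from)
  centre-leaf : ∀ β γ j → Adj G (from (inj₁ β)) (from (inj₂ (γ , j))) ⇔ (β ≡ γ)
  centre-leaf β γ j =
    mk⇔ (λ βj → inj₁-injective (from-injective e (proj₂ (leaf γ j) _ (Graph.sym G βj))))
        λ { refl → Graph.sym G (proj₁ (leaf γ j)) }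
  adjacency : ∀ x y → Adj G (from x) (from y) ⇔ DSAdj a x y
  adjacency (inj₁ true) (inj₁ true) = mk⇔ (irrefl G) λ ()
  adjacency (inj₁ true) (inj₁ false) = mk⇔ _ λ _ → centres
  adjacency (inj₁ false) (inj₁ true) = mk⇔ _ λ _ → Graph.sym G centres
  adjacency (inj₁ false) (inj₁ false) = mk⇔ (irrefl G) λ ()
  adjacency (inj₁ true) (inj₂ (γ , j)) = centre-leaf true γ j
  adjacency (inj₁ false) (inj₂ (γ , j)) = centre-leaf false γ j
  adjacency (inj₂ (β , i)) (inj₁ γ) =
    mk⇔ (λ iγ → inj₁-injective (from-injective e (proj₂ (leaf β i) _ iγ)))
        λ { refl → proj₁ (leaf β i) }
  adjacency (inj₂ (β , i)) (inj₂ (γ , j)) =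
    mk⇔ (λ ij → inj₂≢inj₁ (from-injective e (proj₂ (leaf β i) _ ij))) λ ()
    where
    inj₂≢inj₁ : inj₂ (γ , j) ≢ inj₁ β
    inj₂≢inj₁ ()

pivot↔ : ∀ {m} (X : Fin (suc m)) → Fin (suc m) ↔ (⊤ ⊎ Fin m)
pivot↔ {m} X = mk↔ₛ′ to from to-from from-to
  where
  to : Fin (suc m) → ⊤ ⊎ Fin m
  to u with u ≟ᶠ X
  ... | yes _ = inj₁ tt
  ... | no u≢X = inj₂ (punchOut (u≢X ∘ sym))
  from : ⊤ ⊎ Fin m → Fin (suc m)
  from (inj₁ _) = X
  from (inj₂ i) = punchIn X i
  to-from : ∀ y → to (from y) ≡ y
  to-from (inj₁ _) with X ≟ᶠ X
  ... | yes _ = refl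
  ... | no X≢X = ⊥-elim (X≢X refl)
  to-from (inj₂ i) with punchIn X i ≟ᶠ X
  ... | yes i≡X = ⊥-elim (Finₚ.punchInᵢ≢i X i i≡X)
  ... | no _ = cong inj₂ (trans (Finₚ.punchOut-cong X refl) (Finₚ.punchOut-punchIn X))
  from-to : ∀ u → from (to u) ≡ u
  from-to u with u ≟ᶠ X
  ... | yes u≡X = sym u≡X
  ... | no u≢X = Finₚ.punchIn-punchOut (u≢X ∘ sym)

star-of-centre : ∀ {n} (G : Graph (Fin n)) (X : Fin n) → (∀ u → u ≢ X → Pendant G u X) →
                 ∀ {a c} → a ≢ X → c ≢ X → a ≢ c → IsStar G
star-of-centre {suc m} G X leaf a≢X c≢X a≢c =
  m , ≤-pred (3≤-of-distinct (a≢X ∘ sym) (c≢X ∘ sym) a≢c) ,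
  star-of-bijection G (pivot↔ X) (λ i → leaf (punchIn X i) (Finₚ.punchInᵢ≢i X i))

record Partition {n} (p : Fin n → Bool) : Set where
  field
    k l : ℕ
    bijection : Fin n ↔ (Fin k ⊎ Fin l)
    k≡count : k ≡ count p
    l≡count : l ≡ count (not ∘ p)
    left : ∀ i → p (Inverse.from bijection (inj₁ i)) ≡ true
    right : ∀ j → p (Inverse.from bijection (inj₂ j)) ≡ false

cons-left : ∀ {n k l} → Fin n ↔ (Fin k ⊎ Fin l) → Fin (suc n) ↔ (Fin (suc k) ⊎ Fin l)
cons-left {n} {k} {l} e = mk↔ₛ′ to from to-from from-to
  where
  module e = Inverse e
  to : Fin (suc n) → Fin (suc k) ⊎ Fin l
  to zero = inj₁ zero
  to (suc u) = map₁ suc (e.to u)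
  from : Fin (suc k) ⊎ Fin l → Fin (suc n)
  from (inj₁ zero) = zero
  from (inj₁ (suc i)) = suc (e.from (inj₁ i))
  from (inj₂ j) = suc (e.from (inj₂ j))
  to-from : ∀ y → to (from y) ≡ y
  to-from (inj₁ zero) = refl
  to-from (inj₁ (suc i)) = cong (map₁ suc) (e.strictlyInverseˡ (inj₁ i))
  to-from (inj₂ j) = cong (map₁ suc) (e.strictlyInverseˡ (inj₂ j))
  from-map₁ : ∀ y → from (map₁ suc y) ≡ suc (e.from y)
  from-map₁ (inj₁ i) = refl
  from-map₁ (inj₂ j) = refl
  from-to : ∀ u → from (to u) ≡ u
  from-to zero = refl
  from-to (suc u) = trans (from-map₁ (e.to u)) (cong suc (e.strictlyInverseʳ u))

cons-right : ∀ {n k l} → Fin n ↔ (Fin k ⊎ Fin l) → Fin (suc n) ↔ (Fin k ⊎ Fin (suc l))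
cons-right e = ↔-trans (cons-left (↔-trans e (⊎-comm _ _))) (⊎-comm _ _)

count-cons : ∀ {n} (p : Fin (suc n) → Bool) {b} → p zero ≡ b →
             count p ≡ (if b then 1 else 0) + count (p ∘ suc)
count-cons p refl = refl

partition : ∀ {n} (p : Fin n → Bool) → Partition p
partition {zero} p = record
  { bijection = mk↔ₛ′ (λ ()) (λ { (inj₁ ()) ; (inj₂ ()) }) (λ { (inj₁ ()) ; (inj₂ ()) }) (λ ())
  ; k≡count = refl ; l≡count = refl ; left = λ () ; right = λ () }
partition {suc n} p with partition (p ∘ suc) | p zero in p₀
... | P | true = record
  { bijection = cons-left bijection
  ; k≡count = trans (cong suc k≡count) (sym (count-cons p p₀))
  ; l≡count = trans l≡count (sym (count-cons (not ∘ p) (cong not p₀)))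
  ; left = λ { zero → p₀ ; (suc i) → left i } ; right = right }
  where open Partition P
... | P | false = record
  { bijection = cons-right bijection
  ; k≡count = trans k≡count (sym (count-cons p p₀))
  ; l≡count = trans (cong suc l≡count) (sym (count-cons (not ∘ p) (cong not p₀)))
  ; left = left ; right = λ { zero → p₀ ; (suc j) → right j } }
  where open Partition P

double-star-shape : ∀ {a} → ((⊤ ⊎ Fin a) ⊎ (⊤ ⊎ Fin a)) ↔ (Bool ⊎ (Bool × Fin a))
double-star-shape = mk↔ₛ′ to from to-from from-to
  where
  to : _ → _
  to (inj₁ (inj₁ _)) = inj₁ true
  to (inj₁ (inj₂ i)) = inj₂ (true , i)
  to (inj₂ (inj₁ _)) = inj₁ false
  to (inj₂ (inj₂ i)) = inj₂ (false , i)
  from : _ → _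
  from (inj₁ true) = inj₁ (inj₁ tt)
  from (inj₁ false) = inj₂ (inj₁ tt)
  from (inj₂ (true , i)) = inj₁ (inj₂ i)
  from (inj₂ (false , i)) = inj₂ (inj₂ i)
  to-from : ∀ y → to (from y) ≡ y
  to-from (inj₁ true) = refl
  to-from (inj₁ false) = refl
  to-from (inj₂ (true , i)) = refl
  to-from (inj₂ (false , i)) = refl
  from-to : ∀ x → from (to x) ≡ x
  from-to (inj₁ (inj₁ _)) = refl
  from-to (inj₁ (inj₂ i)) = refl
  from-to (inj₂ (inj₁ _)) = refl
  from-to (inj₂ (inj₂ i)) = refl

module _ {n} (G : Graph (Fin n)) (side : Fin n → Bool) where

  module Sides {k l} (B : Fin n ↔ (Fin k ⊎ Fin l))
               (left : ∀ i → side (Inverse.from B (inj₁ i)) ≡ true)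
               (right : ∀ j → side (Inverse.from B (inj₂ j)) ≡ false) where
    open Inverse B

    left-index : ∀ {u} → side u ≡ true → Σ[ i ∈ Fin k ] to u ≡ inj₁ i
    left-index {u} u-left with to u in e
    ... | inj₁ i = i , refl
    ... | inj₂ j =
      contradiction (trans (sym u-left) (trans (cong side (sym (to≡⇒from≡ B e))) (right j))) λ ()

    right-index : ∀ {u} → side u ≡ false → Σ[ j ∈ Fin l ] to u ≡ inj₂ j
    right-index {u} u-right with to u in e
    ... | inj₂ j = j , refl
    ... | inj₁ i = contradiction (trans (sym (left i)) (trans (cong side (to≡⇒from≡ B e)) u-right)) λ ()

  double-star-of-sides : ∀ {X Y} → side X ≡ true → side Y ≡ false → Adj G X Y →
                         (∀ u → side u ≡ true → u ≢ X → Pendant G u X) →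
                         (∀ u → side u ≡ false → u ≢ Y → Pendant G u Y) →
                         count side ≡ count (not ∘ side) →
                         ∀ {w} → side w ≡ true → w ≢ X → IsBalancedDoubleStar G
  double-star-of-sides {X} {Y} X-left Y-right XY X-leaf Y-leaf balanced {w} w-left w≢X =
    of-equal-sides (trans k≡count (trans balanced (sym l≡count))) bijection left right
    where
    open Partition (partition side)
    of-equal-sides : ∀ {k l} → k ≡ l → (B : Fin n ↔ (Fin k ⊎ Fin l)) →
                     (∀ i → side (Inverse.from B (inj₁ i)) ≡ true) →
                     (∀ j → side (Inverse.from B (inj₂ j)) ≡ false) → IsBalancedDoubleStar G
    of-equal-sides {zero} refl B left right with Sides.left-index B left right X-left
    ... | () , _
    of-equal-sides {suc a} refl B left right =
      a , 1≤-of-distinct iw≢iX , double-star-of-bijection G E (subst₂ (Adj G) (sym X≡) (sym Y≡) XY) leaf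
      where
      open Sides B left right
      iX = proj₁ (left-index X-left)
      iY = proj₁ (right-index Y-right)
      iw = proj₁ (left-index w-left)
      E : Fin n ↔ (Bool ⊎ (Bool × Fin a))
      E = ↔-trans B (↔-trans (pivot↔ iX ⊎-↔ pivot↔ iY) double-star-shape)
      X≡ : Inverse.from E (inj₁ true) ≡ X
      X≡ = to≡⇒from≡ B (proj₂ (left-index X-left))
      Y≡ : Inverse.from E (inj₁ false) ≡ Y
      Y≡ = to≡⇒from≡ B (proj₂ (right-index Y-right))
      iw≢iX : iw ≢ iX
      iw≢iX iw≡iX = w≢X (to-injective B (trans (proj₂ (left-index w-left))
                                          (trans (cong inj₁ iw≡iX) (sym (proj₂ (left-index X-left))))))
      leaf : ∀ β i → Pendant G (Inverse.from E (inj₂ (β , i))) (Inverse.from E (inj₁ β))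
      leaf true i = subst (Pendant G _) (sym X≡) (X-leaf _ (left (punchIn iX i))
        λ e → Finₚ.punchInᵢ≢i iX i (inj₁-injective (from-injective B (trans e (sym X≡)))))
      leaf false i = subst (Pendant G _) (sym Y≡) (Y-leaf _ (right (punchIn iY i))
        λ e → Finₚ.punchInᵢ≢i iY i (inj₂-injective (from-injective B (trans e (sym Y≡)))))

-- Statuses

module Statuses {n : ℕ} (G : Graph (Fin n))
                (D : Fin n → Fin n → ℕ) (dist : ∀ u v → Dist G u v (D u v)) where

  open Metric G D dist

  status : Fin n → ℕ
  status v = ∑ (D v)

  status-of-Status : ∀ {v s} → Status G v s → status v ≡ s
  status-of-Status {v} (d , δ , e) = trans (∑-cong (λ u → Dist-unique G (dist v u) (δ u))) e

  universal-status : ∀ {v} → (∀ w → w ≢ v → Adj G v w) → status v + 1 ≡ n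
  universal-status {v} adj = begin
    status v + 1           ≡⟨ ∑-agree-off v (λ w w≢v → adj⇒D≡1 (adj w w≢v)) ⟩
    ∑ {n} (λ _ → 1) + D v v ≡⟨ cong₂ _+_ (∑-const-1 n) (D-refl v) ⟩
    n + 0                  ≡⟨ +-identityʳ n ⟩
    n                      ∎
    where open ≡-Reasoning

  status-pendant : ∀ {u p} → Pendant G u p → status u + 2 ≡ status p + n
  status-pendant {u} {p} u-pendant = begin
    status u + 2                      ≡⟨ cong (λ d → status u + suc d) (adj⇒D≡1 p-u) ⟨
    status u + suc (D p u)            ≡⟨ ∑-agree-off u (λ w → pendant-distance u-pendant) ⟩
    ∑ (λ w → 1 + D p w) + D u u       ≡⟨ cong₂ _+_ (∑-distrib-+ (λ _ → 1) (D p)) (D-refl u) ⟩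
    ∑ {n} (λ _ → 1) + status p + 0    ≡⟨ cong (λ k → k + status p + 0) (∑-const-1 n) ⟩
    n + status p + 0                  ≡⟨ trans (+-identityʳ _) (+-comm n (status p)) ⟩
    status p + n                      ∎
    where
    open ≡-Reasoning
    p-u : Adj G p u
    p-u = Graph.sym G (proj₁ u-pendant)

  status-invariant : (σ : G ≅ G) → ∀ u → status (Inverse.to (proj₁ σ) u) ≡ status u
  status-invariant σ u = begin
    ∑ (D (σ⟨ u ⟩))              ≡⟨ ∑-permute (D σ⟨ u ⟩) (proj₁ σ) ⟩
    ∑ (λ w → D σ⟨ u ⟩ σ⟨ w ⟩)   ≡⟨ ∑-cong (D-invariant σ u) ⟩
    ∑ (D u)                     ∎
    where
    open ≡-Reasoning
    σ⟨_⟩ : Fin n → Fin n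
    σ⟨_⟩ = Inverse.to (proj₁ σ)

  KIsTwo-of-pendants : 3 ≤ n → ∀ {c l} → Pendant G l c →
                       (∀ u → status u ≡ status c ⊎ Σ[ p ∈ Fin n ] Pendant G u p × status p ≡ status c) →
                       KIsTwo G
  KIsTwo-of-pendants 3≤n {c} {l} l-pendant roles =
    status c , status l , c≢l , two , (c , D c , dist c , refl) , (l , D l , dist l , refl)
    where
    l-status : status l + 2 ≡ status c + n
    l-status = status-pendant l-pendant
    c≢l : status c ≢ status l
    c≢l e = <⇒≢ 3≤n (+-cancelˡ-≡ (status l) 2 n (trans l-status (cong (_+ n) e)))
    two : ∀ v → Status G v (status c) ⊎ Status G v (status l)
    two v with roles v
    ... | inj₁ e = inj₁ (D v , dist v , e)
    ... | inj₂ (p , v-pendant , e) =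
      inj₂ (D v , dist v , +-cancelʳ-≡ 2 _ _ (begin
        status v + 2   ≡⟨ status-pendant v-pendant ⟩
        status p + n   ≡⟨ cong (_+ n) e ⟩
        status c + n   ≡⟨ l-status ⟨
        status l + 2   ∎))
      where open ≡-Reasoning

module TreeStatuses {n : ℕ} (G : Graph (Fin n)) (acyclic : Acyclic G)
                    (D : Fin n → Fin n → ℕ) (dist : ∀ u v → Dist G u v (D u v)) where

  open Metric G D dist
  open AcyclicMetric _≟ᶠ_ G acyclic D dist
  open Statuses G D dist

  status-strictly-convex : ∀ {a b c} → Adj G b a → Adj G b c → a ≢ c →
                           status b + status b < status a + status c
  status-strictly-convex {a} {b} {c} ba bc a≢c =
    subst₂ _<_ (∑-distrib-+ (D b) (D b)) (∑-distrib-+ (D a) (D c))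
      (∑-mono-< {f = λ z → D b z + D b z} (distance-convex ba bc a≢c) b at-b)
    where
    at-b : D b b + D b b < D a b + D c b
    at-b rewrite D-refl b | adj⇒D≡1 (Graph.sym G ba) | adj⇒D≡1 (Graph.sym G bc) = s≤s z≤n

  nearer : Fin n → Fin n → Fin n → Bool
  nearer b c u = D b u <ᵇ D c u

  nearer-spec : ∀ {b c} → Adj G b c → ∀ u → nearer b c u ≡ true  × D c u ≡ suc (D b u)
                                          ⊎ nearer b c u ≡ false × D b u ≡ suc (D c u)
  nearer-spec {b} {c} bc u with adjacent-distances bc u | nearer b c u in eq
  ... | inj₁ c≡1+b | true  = inj₁ (refl , c≡1+b)
  ... | inj₂ b≡1+c | false = inj₂ (refl , b≡1+c)
  ... | inj₁ c≡1+b | false = ⊥-elim (subst T eq (<⇒<ᵇ (subst (D b u <_) (sym c≡1+b) (n<1+n _))))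
  ... | inj₂ b≡1+c | true  =
    ⊥-elim (<⇒≱ (<ᵇ⇒< _ _ (subst T (sym eq) tt)) (subst (D c u ≤_) (sym b≡1+c) (n≤1+n _)))

  status-across-edge : ∀ {b c} → Adj G b c →
                       status b + count (nearer b c) ≡ status c + count (not ∘ nearer b c)
  status-across-edge {b} {c} bc = begin
    status b + count (nearer b c)                              ≡⟨ ∑-distrib-+ (D b) _ ⟨
    ∑ (λ u → D b u + (if nearer b c u then 1 else 0))          ≡⟨ ∑-cong pointwise ⟩
    ∑ (λ u → D c u + (if not (nearer b c u) then 1 else 0))    ≡⟨ ∑-distrib-+ (D c) _ ⟩
    status c + count (not ∘ nearer b c)                        ∎
    where
    open ≡-Reasoning
    pointwise : ∀ u → D b u + (if nearer b c u then 1 else 0) ≡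
                      D c u + (if not (nearer b c u) then 1 else 0)
    pointwise u with nearer-spec bc u
    ... | inj₁ (e , c≡1+b) rewrite e = trans (+-comm (D b u) 1) (sym (trans (+-identityʳ _) c≡1+b))
    ... | inj₂ (e , b≡1+c) rewrite e = trans (+-identityʳ _) (trans b≡1+c (+-comm 1 (D c u)))

-- Trees whose statuses take two values

module Centres {V : Set} (_≟_ : DecidableEquality V) (G : Graph V)
               (D : V → V → ℕ) (dist : ∀ u v → Dist G u v (D u v)) {b c : V}
               (only-b : ∀ e → Adj G b e → Internal G e → e ≡ c)
               (only-c : ∀ e → Adj G c e → Internal G e → e ≡ b) where

  open Metric G D dist

  within-two : ∀ u → D b u ≤ 2
  within-two u with D b u in e
  ... | zero = z≤n
  ... | suc zero = s≤s z≤n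
  ... | suc (suc zero) = s≤s (s≤s z≤n)
  ... | suc (suc (suc k)) with internal-towards e
  ...   | x , bx , Ix , ex with only-b x bx Ix
  ...     | refl with internal-towards ex
  ...       | y , cy , Iy , ey with only-c y cy Iy
  ...         | refl = ⊥-elim (<⇒≢ (m<n⇒m<1+n (n<1+n (suc k))) (trans (sym ey) e))

  nearer-is-pendant : ∀ {u} → u ≢ b → D b u < D c u → Pendant G u b
  nearer-is-pendant {u} u≢b b<c with D b u in e
  ... | zero = ⊥-elim (u≢b (sym (D≡0⇒≡ e)))
  ... | suc (suc zero) with internal-towards e
  ...   | x , bx , Ix , ex with only-b x bx Ix
  ...     | refl = ⊥-elim (<⇒≱ b<c (subst (_≤ 2) (sym ex) (n≤1+n 1)))
  nearer-is-pendant {u} u≢b b<c | suc (suc (suc _)) =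
    ⊥-elim (<⇒≱ (s≤s (s≤s (s≤s z≤n))) (subst (_≤ 2) e (within-two u)))
  nearer-is-pendant {u} u≢b b<c | suc zero = Graph.sym G bu , only-b-neighbour
    where
    bu : Adj G b u
    bu = D≡1⇒adj e
    only-b-neighbour : ∀ v → Adj G u v → v ≡ b
    only-b-neighbour v uv with v ≟ b
    ... | yes v≡b = v≡b
    ... | no v≢b with only-b u bu (b , v , Graph.sym G bu , uv , v≢b ∘ sym)
    ...   | refl = ⊥-elim (<⇒≱ b<c (subst (_≤ 1) (sym (D-refl _)) z≤n))

module TwoStatusValues {n : ℕ} (T : Graph (Fin n)) (acyclic : Acyclic T)
                       (D : Fin n → Fin n → ℕ) (dist : ∀ u v → Dist T u v (D u v))
                       {lo hi : ℕ} (lo<hi : lo < hi)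
                       (two-valued : ∀ v → ∑ (D v) ≡ lo ⊎ ∑ (D v) ≡ hi)
                       (lo-attained : ∃[ v ] ∑ (D v) ≡ lo) (hi-attained : ∃[ v ] ∑ (D v) ≡ hi) where

  open Metric T D dist
  open Statuses T D dist
  open TreeStatuses T acyclic D dist

  lo≤status : ∀ v → lo ≤ status v
  lo≤status v with two-valued v
  ... | inj₁ e = ≤-reflexive (sym e)
  ... | inj₂ e = ≤-trans (<⇒≤ lo<hi) (≤-reflexive (sym e))

  status≤hi : ∀ v → status v ≤ hi
  status≤hi v with two-valued v
  ... | inj₁ e = ≤-trans (≤-reflexive e) (<⇒≤ lo<hi)
  ... | inj₂ e = ≤-reflexive e

  internal⇒lo : ∀ {b} → Internal T b → status b ≡ lo
  internal⇒lo {b} (a , c , ba , bc , a≢c) with two-valued b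
  ... | inj₁ e = e
  ... | inj₂ e = ⊥-elim (<⇒≱ (status-strictly-convex ba bc a≢c) (begin
    status a + status c   ≤⟨ +-mono-≤ (status≤hi a) (status≤hi c) ⟩
    hi + hi               ≡⟨ cong₂ _+_ e e ⟨
    status b + status b   ∎))
    where open ≤-Reasoning

  lo-neighbours-equal : ∀ {a b c} → Adj T b a → Adj T b c → status a ≡ lo → status c ≡ lo → a ≡ c
  lo-neighbours-equal {a} {b} {c} ba bc a-lo c-lo with a ≟ᶠ c
  ... | yes a≡c = a≡c
  ... | no a≢c = ⊥-elim (<⇒≱ (status-strictly-convex ba bc a≢c) (begin
    status a + status c   ≡⟨ cong₂ _+_ a-lo c-lo ⟩
    lo + lo               ≤⟨ +-mono-≤ (lo≤status b) (lo≤status b) ⟩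
    status b + status b   ∎))
    where open ≤-Reasoning

  internal-neighbour-unique : ∀ {b c} → Adj T b c → Internal T c →
                              ∀ e → Adj T b e → Internal T e → e ≡ c
  internal-neighbour-unique bc Ic e be Ie = lo-neighbours-equal be bc (internal⇒lo Ie) (internal⇒lo Ic)

  Internal? : ∀ b → Dec (Internal T b)
  Internal? b = any? λ a → any? λ c → adj? b a ×-dec adj? b c ×-dec ¬? (a ≟ᶠ c)

  status-if-no-internal : (∀ x → ¬ Internal T x) → ∀ v → status v + 1 ≡ n
  status-if-no-internal none v = universal-status adjacent
    where
    adjacent : ∀ w → w ≢ v → Adj T v w
    adjacent w w≢v with adjacent-or-internal-towards (w≢v ∘ sym)
    ... | inj₁ vw = vw
    ... | inj₂ (x , _ , Ix) = ⊥-elim (none x Ix)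

  some-internal : ∃ (Internal T)
  some-internal with any? Internal?
  ... | yes I = I
  ... | no none =
    ⊥-elim (<⇒≢ lo<hi (+-cancelʳ-≡ 1 lo hi (trans (value lo-attained) (sym (value hi-attained)))))
    where
    value : ∀ {s} → ∃[ v ] status v ≡ s → s + 1 ≡ n
    value (v , e) = trans (cong (_+ 1) (sym e)) (status-if-no-internal (λ x Ix → none (x , Ix)) v)

  star-case : ∀ {b} → Internal T b → (∀ c → Adj T b c → ¬ Internal T c) → IsStar T
  star-case {b} (a , c , ba , bc , a≢c) no-internal =
    star-of-centre T b leaf (adj⇒≢ T ba ∘ sym) (adj⇒≢ T bc ∘ sym) a≢c
    where
    leaf : ∀ u → u ≢ b → Pendant T u b
    leaf u u≢b with adjacent-or-internal-towards (u≢b ∘ sym)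
    ... | inj₂ (x , bx , Ix) = ⊥-elim (no-internal x bx Ix)
    ... | inj₁ bu = Graph.sym T bu , only-b
      where
      only-b : ∀ v → Adj T u v → v ≡ b
      only-b v uv with v ≟ᶠ b
      ... | yes v≡b = v≡b
      ... | no v≢b = ⊥-elim (no-internal u bu (b , v , Graph.sym T bu , uv , v≢b ∘ sym))

  double-star-case : ∀ {b c} → Adj T b c → Internal T b → Internal T c → IsBalancedDoubleStar T
  double-star-case {b} {c} bc Ib@(a₁ , a₂ , ba₁ , ba₂ , a₁≢a₂) Ic =
    let w , bw , w≢c = other-neighbour in
    double-star-of-sides T (nearer b c) b-side c-side bc b-leaf c-leaf balanced
                         (neighbour-side bw w≢c) (adj⇒≢ T bw ∘ sym)
    where
    only-b : ∀ e → Adj T b e → Internal T e → e ≡ c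
    only-b = internal-neighbour-unique bc Ic
    only-c : ∀ e → Adj T c e → Internal T e → e ≡ b
    only-c = internal-neighbour-unique (Graph.sym T bc) Ib
    module B = Centres _≟ᶠ_ T D dist only-b only-c
    module C = Centres _≟ᶠ_ T D dist only-c only-b
    b-side : nearer b c b ≡ true
    b-side = cong₂ _<ᵇ_ (D-refl b) (adj⇒D≡1 (Graph.sym T bc))
    c-side : nearer b c c ≡ false
    c-side = cong₂ _<ᵇ_ (adj⇒D≡1 bc) (D-refl c)
    b-leaf : ∀ u → nearer b c u ≡ true → u ≢ b → Pendant T u b
    b-leaf u u-b u≢b with nearer-spec bc u
    ... | inj₁ (_ , c≡1+b) = B.nearer-is-pendant u≢b (≤-reflexive (sym c≡1+b))
    ... | inj₂ (u-c , _) = contradiction (trans (sym u-b) u-c) λ ()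
    c-leaf : ∀ u → nearer b c u ≡ false → u ≢ c → Pendant T u c
    c-leaf u u-c u≢c with nearer-spec bc u
    ... | inj₂ (_ , b≡1+c) = C.nearer-is-pendant u≢c (≤-reflexive (sym b≡1+c))
    ... | inj₁ (u-b , _) = contradiction (trans (sym u-b) u-c) λ ()
    balanced : count (nearer b c) ≡ count (not ∘ nearer b c)
    balanced = +-cancelˡ-≡ lo _ _ (begin
      lo + count (nearer b c)               ≡⟨ cong (_+ _) (internal⇒lo Ib) ⟨
      status b + count (nearer b c)         ≡⟨ status-across-edge bc ⟩
      status c + count (not ∘ nearer b c)   ≡⟨ cong (_+ _) (internal⇒lo Ic) ⟩
      lo + count (not ∘ nearer b c)         ∎)
      where open ≡-Reasoning
    other-neighbour : Σ[ w ∈ Fin n ] Adj T b w × w ≢ c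
    other-neighbour with a₁ ≟ᶠ c
    ... | yes refl = a₂ , ba₂ , a₁≢a₂ ∘ sym
    ... | no a₁≢c = a₁ , ba₁ , a₁≢c
    neighbour-side : ∀ {w} → Adj T b w → w ≢ c → nearer b c w ≡ true
    neighbour-side {w} bw w≢c with nearer b c w in e
    ... | true = refl
    ... | false = ⊥-elim (adj⇒≢ T bc (proj₂ (c-leaf w e w≢c) b (Graph.sym T bw)))

  classification : IsStar T ⊎ IsBalancedDoubleStar T
  classification with some-internal
  ... | b , Ib with any? (λ c → adj? b c ×-dec Internal? c)
  ...   | yes (c , bc , Ic) = inj₂ (double-star-case bc Ib Ic)
  ...   | no none = inj₁ (star-case Ib λ c bc Ic → none (c , bc , Ic))

k≡2⇒star-or-double-star : ∀ {n} (T : Graph (Fin n)) → Acyclic T → KIsTwo T →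
                          IsStar T ⊎ IsBalancedDoubleStar T
k≡2⇒star-or-double-star {n} T acyclic (s , t , s≢t , two , (v₁ , v₁-s) , (v₂ , v₂-t)) =
  by-order (<-cmp s t)
  where
  distances : ∀ v → Σ[ d ∈ (Fin n → ℕ) ] (∀ u → Dist T v u (d u))
  distances v = [ (λ (d , δ , _) → d , δ) , (λ (d , δ , _) → d , δ) ]′ (two v)
  D : Fin n → Fin n → ℕ
  D v = proj₁ (distances v)
  dist : ∀ u v → Dist T u v (D u v)
  dist u = proj₂ (distances u)
  open Statuses T D dist using (status-of-Status)
  values : ∀ v → ∑ (D v) ≡ s ⊎ ∑ (D v) ≡ t
  values v = Sum.map status-of-Status status-of-Status (two v)
  by-order : Tri (s < t) (s ≡ t) (t < s) → IsStar T ⊎ IsBalancedDoubleStar T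
  by-order (tri< s<t _ _) = TwoStatusValues.classification T acyclic D dist s<t values
                              (v₁ , status-of-Status v₁-s) (v₂ , status-of-Status v₂-t)
  by-order (tri≈ _ s≡t _) = ⊥-elim (s≢t s≡t)
  by-order (tri> _ _ t<s) = TwoStatusValues.classification T acyclic D dist t<s (Sum.swap ∘ values)
                              (v₂ , status-of-Status v₂-t) (v₁ , status-of-Status v₁-s)

-- Statuses of stars and double stars

K1-leaf : ∀ {m} (i : Fin m) → Pendant (K1 m) (inj₂ i) (inj₁ tt)
K1-leaf i = tt , λ { (inj₁ _) _ → refl ; (inj₂ _) () }

K1-centre-distance : ∀ {m} y → ∃[ d ] Dist (K1 m) (inj₁ tt) y d
K1-centre-distance (inj₁ _) = 0 , Dist-refl (K1 _)
K1-centre-distance (inj₂ _) = 1 , Dist-adj (K1 _) tt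

K1-distance : ∀ {m} x y → ∃[ d ] Dist (K1 m) x y d
K1-distance (inj₁ _) = K1-centre-distance
K1-distance (inj₂ i) = ∃Dist-pendant (Sumₚ.≡-dec ⊤ₚ._≟_ _≟ᶠ_) (K1 _) (K1-leaf i) K1-centre-distance

DS-leaf : ∀ {a} β (i : Fin a) → Pendant (DS a) (inj₂ (β , i)) (inj₁ β)
DS-leaf β i = refl , λ { (inj₁ _) γ≡β → cong inj₁ γ≡β ; (inj₂ _) () }

DS-centre-distance : ∀ {a} β y → ∃[ d ] Dist (DS a) (inj₁ β) y d
DS-centre-distance true  (inj₁ true)  = 0 , Dist-refl (DS _)
DS-centre-distance true  (inj₁ false) = 1 , Dist-adj (DS _) tt
DS-centre-distance false (inj₁ true)  = 1 , Dist-adj (DS _) tt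
DS-centre-distance false (inj₁ false) = 0 , Dist-refl (DS _)
DS-centre-distance true  (inj₂ (true , _))  = 1 , Dist-adj (DS _) refl
DS-centre-distance true  (inj₂ (false , _)) = 2 , Dist-two (DS _) {w = inj₁ false} (λ ()) (λ ()) tt refl
DS-centre-distance false (inj₂ (true , _))  = 2 , Dist-two (DS _) {w = inj₁ true} (λ ()) (λ ()) tt refl
DS-centre-distance false (inj₂ (false , _)) = 1 , Dist-adj (DS _) refl

DS-distance : ∀ {a} x y → ∃[ d ] Dist (DS a) x y d
DS-distance (inj₁ β) = DS-centre-distance β
DS-distance (inj₂ (β , i)) =
  ∃Dist-pendant (Sumₚ.≡-dec Boolₚ._≟_ (Productₚ.≡-dec Boolₚ._≟_ _≟ᶠ_)) (DS _) (DS-leaf β i)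
                (DS-centre-distance β)

DS-swap : ∀ {a} → DS a ≅ DS a
DS-swap {a} = mk↔ₛ′ swap swap swap-swap swap-swap , adjacency
  where
  swap : Bool ⊎ (Bool × Fin a) → Bool ⊎ (Bool × Fin a)
  swap = Sum.map not (Product.map₁ not)
  swap-swap : ∀ x → swap (swap x) ≡ x
  swap-swap (inj₁ β) = cong inj₁ (Boolₚ.not-involutive β)
  swap-swap (inj₂ (β , i)) = cong (λ γ → inj₂ (γ , i)) (Boolₚ.not-involutive β)
  adjacency : ∀ x y → DSAdj a x y ⇔ DSAdj a (swap x) (swap y)
  adjacency (inj₁ true)  (inj₁ true)  = mk⇔ id id
  adjacency (inj₁ true)  (inj₁ false) = mk⇔ id id
  adjacency (inj₁ false) (inj₁ true)  = mk⇔ id id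
  adjacency (inj₁ false) (inj₁ false) = mk⇔ id id
  adjacency (inj₁ true)  (inj₂ _) = mk⇔ (cong not) Boolₚ.not-injective
  adjacency (inj₁ false) (inj₂ _) = mk⇔ (cong not) Boolₚ.not-injective
  adjacency (inj₂ _) (inj₁ _) = mk⇔ (cong not) Boolₚ.not-injective
  adjacency (inj₂ _) (inj₂ _) = mk⇔ id id

star⇒k≡2 : ∀ {n} (T : Graph (Fin n)) → IsStar T → KIsTwo T
star⇒k≡2 {n} T (suc (suc m) , s≤s (s≤s z≤n) , f) =
  KIsTwo-of-pendants (3≤-of-distinct {x = X} {leaf zero} {leaf (suc zero)}
                                     (distinct λ ()) (distinct λ ()) (distinct λ ()))
                     (leaf-pendant zero) roles
  where
  open Inverse (proj₁ f) using (from)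
  distinct : ∀ {x y} → x ≢ y → from x ≢ from y
  distinct x≢y = x≢y ∘ from-injective (proj₁ f)
  distances : ∀ u v → ∃[ d ] Dist T u v d
  distances = ∃Dist-reflect f K1-distance
  open Statuses T (λ u v → proj₁ (distances u v)) (λ u v → proj₂ (distances u v))
  X = from (inj₁ tt)
  leaf : Fin (suc (suc m)) → Fin n
  leaf i = from (inj₂ i)
  leaf-pendant : ∀ i → Pendant T (leaf i) X
  leaf-pendant i = Pendant-from {G = T} {K1 _} f (K1-leaf i)
  roles : ∀ u → status u ≡ status X ⊎ Σ[ p ∈ Fin n ] Pendant T u p × status p ≡ status X
  roles = by-image (proj₁ f) λ where
    (inj₁ _) → inj₁ refl
    (inj₂ i) → inj₂ (X , leaf-pendant i , refl)

double-star⇒k≡2 : ∀ {n} (T : Graph (Fin n)) → IsBalancedDoubleStar T → KIsTwo T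
double-star⇒k≡2 {n} T (suc a , s≤s z≤n , f) =
  KIsTwo-of-pendants (3≤-of-distinct {x = X} {centre false} {leaf true zero}
                                     (distinct λ ()) (distinct λ ()) (distinct λ ()))
                     (leaf-pendant true zero) roles
  where
  open Inverse (proj₁ f) using (from; strictlyInverseˡ)
  distinct : ∀ {x y} → x ≢ y → from x ≢ from y
  distinct x≢y = x≢y ∘ from-injective (proj₁ f)
  distances : ∀ u v → ∃[ d ] Dist T u v d
  distances = ∃Dist-reflect f DS-distance
  open Statuses T (λ u v → proj₁ (distances u v)) (λ u v → proj₂ (distances u v))
  centre : Bool → Fin n
  centre β = from (inj₁ β)
  leaf : Bool → Fin (suc a) → Fin n
  leaf β i = from (inj₂ (β , i))
  X = centre true
  leaf-pendant : ∀ β i → Pendant T (leaf β i) (centre β)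
  leaf-pendant β i = Pendant-from {G = T} {DS _} f (DS-leaf β i)
  swap-centres : T ≅ T
  swap-centres = ≅-trans {F = T} {DS _} {T} f
                   (≅-trans {F = DS _} {DS _} {T} DS-swap (≅-sym {G = T} {DS _} f))
  centre-status : ∀ β → status (centre β) ≡ status X
  centre-status true = refl
  centre-status false = begin
    status (centre false)                        ≡⟨ cong (status ∘ from ∘ swap) (strictlyInverseˡ _) ⟨
    status (Inverse.to (proj₁ swap-centres) X)   ≡⟨ status-invariant swap-centres X ⟩
    status X                                     ∎
    where
    open ≡-Reasoning
    swap = Inverse.to (proj₁ (DS-swap {suc a}))
  roles : ∀ u → status u ≡ status X ⊎ Σ[ p ∈ Fin n ] Pendant T u p × status p ≡ status X
  roles = by-image (proj₁ f) λ where
    (inj₁ β) → inj₁ (centre-status β)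
    (inj₂ (β , i)) → inj₂ (centre β , leaf-pendant β i , centre-status β)

proposition3p5 : (n : ℕ) (T : Graph (Fin n)) → IsTree T →
    KIsTwo T ⇔ (IsStar T ⊎ IsBalancedDoubleStar T)
proposition3p5 n T (_ , acyclic) =
  mk⇔ (k≡2⇒star-or-double-star T acyclic) [ star⇒k≡2 T , double-star⇒k≡2 T ]′
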